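{- Let $u,\lambda\in\mathbb N^n$ be dominant, let $v$ be a permutation of the components of $u$ and $\mu$ a permutation of the components of $\lambda$. If $(x^v,x^\lambda)_q\neq0$ and $(x^u,x^\mu)_q\neq0$, then $u=\lambda$, $v=\lambda\omega$ and $\mu=u\omega$, where $w\omega=(w_n,\ldots,w_1)$ denotes the reversal of $w$.
   Context: Let $n\ge1$, $q$ an indeterminate, $\mathrm{Pol}=\mathbb{Q}(q)[x_1,\ldots,x_n]$, $x^v=x_1^{v_1}\cdots x_n^{v_n}$; $v$ is dominant if $v_1\ge\cdots\ge v_n$. For $g\in\mathrm{Pol}$, $g^\clubsuit$ is the image of $g$ under $x_i\mapsto1/x_{n+1-i}$, and $(f,g)_q=CT_{x_n}\bigl(\cdots CT_{x_1}\bigl(f\,g^\clubsuit\prod_{1\le i<j\le n}\frac{1-x_i/x_j}{1-qx_i/x_j}\bigr)\cdots\bigr)$, each $(1-qx_i/x_j)^{ -1}$ expanded as $\sum_{k\ge0}q^k(x_i/x_j)^k$, $CT_x$ taking the coefficient of $x^0$. -}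

module Defs where

open import Data.Nat as ℕ using (ℕ; zero; suc; _<ᵇ_)
open import Data.Integer as ℤ using (ℤ; +_; -_; 0ℤ)
open import Data.List as L using (List; []; _∷_; concatMap; foldr; upTo)
open import Data.List.Relation.Unary.All using (All)
open import Data.Vec as V using (Vec)
open import Data.Vec.Properties using (≡-dec)
open import Data.Fin as F using (Fin; toℕ)
open import Data.Product using (_×_; _,_)
open import Data.Bool using (if_then_else_)
open import Data.Nat.ListAction using () renaming (sum to sumℕ)
open import Relation.Nullary.Decidable using (does)
open import Relation.Binary.PropositionalEquality using (_≡_)

-- Coefficients: polynomials in q with integer coefficients,
-- as lists of coefficients (coefficient of q^0 first).
-- Z[q] embeds in Q(q); an element is 0 in Q(q) iff all coefficients are 0.

QPoly : Set
QPoly = List ℤ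

infixl 6 _⊕_
infixl 7 _⊗_

_⊕_ : QPoly → QPoly → QPoly
[] ⊕ b = b
(x ∷ a) ⊕ [] = x ∷ a
(x ∷ a) ⊕ (y ∷ b) = (x ℤ.+ y) ∷ (a ⊕ b)

scaleQ : ℤ → QPoly → QPoly
scaleQ c = L.map (c ℤ.*_)

_⊗_ : QPoly → QPoly → QPoly
[] ⊗ b = []
(x ∷ a) ⊗ b = scaleQ x b ⊕ (0ℤ ∷ (a ⊗ b))

qpow : ℕ → QPoly
qpow zero = + 1 ∷ []
qpow (suc k) = 0ℤ ∷ qpow k

IsZeroQ : QPoly → Set
IsZeroQ p = All (_≡ 0ℤ) p

-- Laurent polynomials in x_1..x_n as finite formal sums of terms
-- (coefficient , exponent vector in Z^n).

Laurent : ℕ → Set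
Laurent n = List (QPoly × Vec ℤ n)

Pol : ℕ → Set
Pol n = List (QPoly × Vec ℕ n)

mono : ∀ {n} → Vec ℕ n → Pol n
mono v = (qpow 0 , v) ∷ []

toLaurent : ∀ {n} → Pol n → Laurent n
toLaurent = L.map (λ { (a , e) → (a , V.map +_ e) })

infixl 7 _⋆_
_⋆_ : ∀ {n} → Laurent n → Laurent n → Laurent n
f ⋆ g = concatMap (λ { (a , e) → L.map (λ { (b , e′) → (a ⊗ b , V.zipWith ℤ._+_ e e′) }) g }) f

oneL : ∀ {n} → Laurent n
oneL {n} = (qpow 0 , V.replicate n 0ℤ) ∷ []

coeff : ∀ {n} → Vec ℤ n → Laurent n → QPoly
coeff e = foldr (λ { (a , e′) acc → if does (≡-dec ℤ._≟_ e′ e) then a ⊕ acc else acc }) []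

-- constant term (coefficient of x_1^0 ... x_n^0); for a finite Laurent
-- polynomial the iterated CT_{x_n}(...CT_{x_1}(.)...) is exactly this.
CT : ∀ {n} → Laurent n → QPoly
CT {n} = coeff (V.replicate n 0ℤ)

-- g^♣ : x_i ↦ 1/x_{n+1-i}; the monomial x^e goes to x^{-(e reversed)}
club : ∀ {n} → Pol n → Laurent n
club = L.map (λ { (a , e) → (a , V.reverse (V.map (λ k → - (+ k)) e)) })

ratioExp : ∀ {n} → Fin n → Fin n → Vec ℤ n
ratioExp i j = V.tabulate (λ k → δ k i ℤ.- δ k j)
  where
  δ : ∀ {n} → Fin n → Fin n → ℤ
  δ k l = if does (k F.≟ l) then + 1 else 0ℤ

pairsLt : (n : ℕ) → List (Fin n × Fin n)
pairsLt n = concatMap (λ i → concatMap (λ j → if toℕ i <ᵇ toℕ j then (i , j) ∷ [] else []) (L.allFin n)) (L.allFin n)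

-- (1 - x_i/x_j) * Σ_{k=0}^{N} q^k (x_i/x_j)^k   (truncation at order N of
-- (1 - x_i/x_j)/(1 - q x_i/x_j) expanded as a power series in x_i/x_j)
factor : ∀ {n} → ℕ → Fin n → Fin n → Laurent n
factor {n} N i j =
  ((qpow 0 , V.replicate n 0ℤ) ∷ ((ℤ.-[1+ 0 ] ∷ []) , ratioExp i j) ∷ [])
  ⋆ L.map (λ k → (qpow k , V.map ((+ k) ℤ.*_) (ratioExp i j))) (upTo (suc N))

Δ : (n : ℕ) → ℕ → Laurent n
Δ n N = foldr (λ { (i , j) acc → factor N i j ⋆ acc }) oneL (pairsLt n)

-- truncation order: for f ∈ Pol and g with total degree d, only terms with
-- Σ_{i<j} k_{ij} ≤ (n-1)·d of the infinite product can contribute to the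
-- constant term of f g^♣ ∏(...), so truncating at n·(sum of degrees of g)
-- gives the exact value of the (iterated) constant term.
truncBound : ∀ {n} → Pol n → ℕ
truncBound {n} g = n ℕ.* sumℕ (L.map (λ { (a , e) → sumℕ (V.toList e) }) g)

pairing : ∀ {n} → Pol n → Pol n → QPoly
pairing {n} f g = CT (toLaurent f ⋆ club g ⋆ Δ n (truncBound g))

Dominant : ∀ {n} → Vec ℕ n → Set
Dominant {n} v = (i j : Fin n) → i F.≤ j → V.lookup v j ℕ.≤ V.lookup v i

{-# OPTIONS --safe #-}
-- Every exponent vector in the expansion of ∏_{i<j} (1 - x_i/x_j)/(1 - q x_i/x_j) is a sum of
-- positive roots e_i - e_j (i < j), i.e. has nonnegative prefix sums and total 0. So if
-- (x^v, x^λ)_q ≠ 0, some such vector cancels the exponent v - λω of x^v (x^λ)^♣, which says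
-- v ⊴ λω in the dominance order of compositions. A dominant vector is the ⊴-largest of its
-- rearrangements, and reversal turns ⊴ around. Hence u ⊴ μω ⊴ λ and λ ⊴ vω ⊴ u, and
-- antisymmetry of ⊴ gives u = λ, vω = λ and μω = u.
module Submission where

open import Defs
open import Data.Product using (_×_; _,_; proj₂; ∃-syntax)
open import Data.List using (List; []; _∷_; foldr)
open import Data.List.Relation.Unary.All as All using (All; []; _∷_)
import Data.List.Relation.Unary.All.Properties as All
open import Data.List.Relation.Binary.Permutation.Propositional using (_↭_)
open import Relation.Binary.PropositionalEquality
open import Function using (_∘_)

foldr-preserves-All : ∀ {A B : Set} {P : A → Set} (Q : B → Set) {f : A → B → B} {e : B} →
  (∀ {x y} → P x → Q y → Q (f x y)) → Q e → ∀ {xs} → All P xs → Q (foldr f e xs)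
foldr-preserves-All Q step qe [] = qe
foldr-preserves-All Q {f} {e} step qe {_ ∷ xs} (px ∷ pxs) =
  step {y = foldr f e xs} px (foldr-preserves-All Q {f} {e} step qe pxs)

module DominanceOrder where

  open import Data.Nat
  open import Data.Nat.Properties
  open import Data.Nat.ListAction using (sum)
  open import Data.Nat.ListAction.Properties using (sum-++; sum-↭)
  open import Data.List using (_++_; take; drop; length; reverse)
  open import Data.List.Properties using (take-all; take++drop≡id; reverse-++; length-reverse; length-drop)
  open import Data.List.Relation.Unary.Any using (here)
  open import Data.List.Relation.Unary.AllPairs using (AllPairs; []; _∷_)
  open import Data.List.Membership.Propositional.Properties using (∈-∃++)
  open import Data.List.Relation.Binary.Permutation.Propositional using (↭-sym; ↭-trans)
  open import Data.List.Relation.Binary.Permutation.Propositional.Properties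
    using (↭-reverse; ↭-empty-inv; ∈-resp-↭; All-resp-↭; drop-mid)
  open import Data.Sum using (inj₁; inj₂)
  open import Data.Vec as V using (Vec; toList)
  import Data.Vec.Properties as V
  import Data.Fin as F
  open import Algebra.Properties.CommutativeSemigroup +-commutativeSemigroup using (x∙yz≈y∙xz)

  prefixSum : ℕ → List ℕ → ℕ
  prefixSum k xs = sum (take k xs)

  infix 4 _⊴_

  record _⊴_ (xs ys : List ℕ) : Set where
    field
      prefixSum-≤ : ∀ k → prefixSum k xs ≤ prefixSum k ys
      sum-≡ : sum xs ≡ sum ys

  open _⊴_ public

  ⊴-trans : ∀ {xs ys zs} → xs ⊴ ys → ys ⊴ zs → xs ⊴ zs
  ⊴-trans p q = record
    { prefixSum-≤ = λ k → ≤-trans (prefixSum-≤ p k) (prefixSum-≤ q k)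
    ; sum-≡ = trans (sum-≡ p) (sum-≡ q)
    }

  prefixSums-injective : ∀ {xs ys} → length xs ≡ length ys →
    (∀ k → prefixSum k xs ≡ prefixSum k ys) → xs ≡ ys
  prefixSums-injective {[]} {[]} _ _ = refl
  prefixSums-injective {x ∷ xs} {y ∷ ys} len eq =
    cong₂ _∷_ x≡y (prefixSums-injective (suc-injective len) tails)
    where
    x≡y : x ≡ y
    x≡y = +-cancelʳ-≡ 0 x y (eq 1)
    tails : ∀ k → prefixSum k xs ≡ prefixSum k ys
    tails k = +-cancelˡ-≡ x _ _ (trans (eq (suc k)) (cong (_+ prefixSum k ys) (sym x≡y)))

  ⊴-antisym : ∀ {xs ys} → length xs ≡ length ys → xs ⊴ ys → ys ⊴ xs → xs ≡ ys
  ⊴-antisym len p q = prefixSums-injective len (λ k → ≤-antisym (prefixSum-≤ p k) (prefixSum-≤ q k))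

  prefixSum-all : ∀ {k} xs → length xs ≤ k → prefixSum k xs ≡ sum xs
  prefixSum-all xs le = cong sum (take-all _ xs le)

  prefixSum+sum-drop : ∀ k xs → prefixSum k xs + sum (drop k xs) ≡ sum xs
  prefixSum+sum-drop k xs = trans (sym (sum-++ (take k xs) (drop k xs))) (cong sum (take++drop≡id k xs))

  sum-reverse : ∀ xs → sum (reverse xs) ≡ sum xs
  sum-reverse xs = sum-↭ (↭-reverse xs)

  take-length-++ : ∀ {A : Set} (xs ys : List A) → take (length xs) (xs ++ ys) ≡ xs
  take-length-++ [] ys = refl
  take-length-++ (x ∷ xs) ys = cong (x ∷_) (take-length-++ xs ys)

  prefixSum-reverse : ∀ j xs → prefixSum j (reverse xs) ≡ sum (drop (length xs ∸ j) xs)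
  prefixSum-reverse j xs with ≤-total j (length xs)
  ... | inj₁ j≤m = begin
    sum (take j (reverse xs))
      ≡⟨ cong (λ zs → sum (take j (reverse zs))) (sym (take++drop≡id d xs)) ⟩
    sum (take j (reverse (take d xs ++ drop d xs)))
      ≡⟨ cong (sum ∘ take j) (reverse-++ (take d xs) (drop d xs)) ⟩
    sum (take j (reverse (drop d xs) ++ reverse (take d xs)))
      ≡⟨ cong (λ i → sum (take i (reverse (drop d xs) ++ reverse (take d xs)))) (sym length-suffix) ⟩
    sum (take (length (reverse (drop d xs))) (reverse (drop d xs) ++ reverse (take d xs)))
      ≡⟨ cong sum (take-length-++ (reverse (drop d xs)) _) ⟩
    sum (reverse (drop d xs))
      ≡⟨ sum-reverse (drop d xs) ⟩
    sum (drop d xs) ∎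
    where
    open ≡-Reasoning
    d = length xs ∸ j
    length-suffix : length (reverse (drop d xs)) ≡ j
    length-suffix = trans (length-reverse (drop d xs)) (trans (length-drop d xs) (m∸[m∸n]≡n j≤m))
  ... | inj₂ m≤j = begin
    prefixSum j (reverse xs) ≡⟨ prefixSum-all (reverse xs) (≤-trans (≤-reflexive (length-reverse xs)) m≤j) ⟩
    sum (reverse xs)         ≡⟨ sum-reverse xs ⟩
    sum xs                   ≡⟨ cong (λ d → sum (drop d xs)) (sym (m≤n⇒m∸n≡0 m≤j)) ⟩
    sum (drop (length xs ∸ j) xs) ∎
    where open ≡-Reasoning

  ⊴⇒sum-drop-≥ : ∀ {xs ys} → xs ⊴ ys → ∀ k → sum (drop k ys) ≤ sum (drop k xs)
  ⊴⇒sum-drop-≥ {xs} {ys} p k = +-cancelˡ-≤ (prefixSum k ys) _ _ (begin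
    prefixSum k ys + sum (drop k ys) ≡⟨ prefixSum+sum-drop k ys ⟩
    sum ys                           ≡⟨ sum-≡ p ⟨
    sum xs                           ≡⟨ prefixSum+sum-drop k xs ⟨
    prefixSum k xs + sum (drop k xs) ≤⟨ +-monoˡ-≤ _ (prefixSum-≤ p k) ⟩
    prefixSum k ys + sum (drop k xs) ∎)
    where open ≤-Reasoning

  ⊴-reverse : ∀ {xs ys} → length xs ≡ length ys → xs ⊴ ys → reverse ys ⊴ reverse xs
  ⊴-reverse {xs} {ys} len p = record
    { prefixSum-≤ = reversed
    ; sum-≡ = trans (sum-reverse ys) (trans (sym (sum-≡ p)) (sym (sum-reverse xs)))
    }
    where
    reversed : ∀ j → prefixSum j (reverse ys) ≤ prefixSum j (reverse xs)
    reversed j = begin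
      prefixSum j (reverse ys)       ≡⟨ prefixSum-reverse j ys ⟩
      sum (drop (length ys ∸ j) ys)  ≡⟨ cong (λ m → sum (drop (m ∸ j) ys)) len ⟨
      sum (drop (length xs ∸ j) ys)  ≤⟨ ⊴⇒sum-drop-≥ p (length xs ∸ j) ⟩
      sum (drop (length xs ∸ j) xs)  ≡⟨ prefixSum-reverse j xs ⟨
      prefixSum j (reverse xs)       ∎
      where open ≤-Reasoning

  prefixSum-swap : ∀ {b c} → c ≤ b → ∀ k zs → c + prefixSum k (b ∷ zs) ≤ b + prefixSum k (c ∷ zs)
  prefixSum-swap c≤b zero zs = +-monoˡ-≤ 0 c≤b
  prefixSum-swap {b} {c} c≤b (suc k) zs = ≤-reflexive (x∙yz≈y∙xz c b (prefixSum k zs))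

  prefixSum-moveToFront : ∀ {b} zs ws → All (_≤ b) zs →
    ∀ k → prefixSum k (zs ++ b ∷ ws) ≤ prefixSum k (b ∷ zs ++ ws)
  prefixSum-moveToFront [] ws [] k = ≤-refl
  prefixSum-moveToFront (c ∷ zs) ws (c≤b ∷ zs≤b) zero = z≤n
  prefixSum-moveToFront {b} (c ∷ zs) ws (c≤b ∷ zs≤b) (suc k) =
    ≤-trans (+-monoʳ-≤ c (prefixSum-moveToFront zs ws zs≤b k)) (prefixSum-swap c≤b k (zs ++ ws))

  prefixSum-≤-sorted : ∀ {xs ys} → AllPairs _≥_ ys → xs ↭ ys → ∀ k → prefixSum k xs ≤ prefixSum k ys
  prefixSum-≤-sorted {ys = []} [] xs↭[] k with refl ← ↭-empty-inv xs↭[] = ≤-refl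
  prefixSum-≤-sorted {ys = b ∷ ys} (b≥ys ∷ sorted) p zero = z≤n
  prefixSum-≤-sorted {ys = b ∷ ys} (b≥ys ∷ sorted) p (suc k)
    with zs , ws , refl ← ∈-∃++ (∈-resp-↭ (↭-sym p) (here refl)) = begin
      prefixSum (suc k) (zs ++ b ∷ ws) ≤⟨ prefixSum-moveToFront zs ws zs≤b (suc k) ⟩
      b + prefixSum k (zs ++ ws)       ≤⟨ +-monoʳ-≤ b (prefixSum-≤-sorted sorted (drop-mid zs [] p) k) ⟩
      b + prefixSum k ys               ∎
    where
    open ≤-Reasoning
    zs≤b : All (_≤ b) zs
    zs≤b = All.++⁻ˡ zs (All-resp-↭ (↭-sym p) (≤-refl ∷ b≥ys))

  ↭-sorted⇒⊴ : ∀ {xs ys} → AllPairs _≥_ ys → xs ↭ ys → xs ⊴ ys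
  ↭-sorted⇒⊴ sorted p = record { prefixSum-≤ = prefixSum-≤-sorted sorted p ; sum-≡ = sum-↭ p }

  dominant⇒sorted : ∀ {n} {u : Vec ℕ n} → Dominant u → AllPairs _≥_ (toList u)
  dominant⇒sorted {u = V.[]} D = []
  dominant⇒sorted {u = x V.∷ u} D =
    head≥ u (λ j → D F.zero (F.suc j) z≤n) ∷ dominant⇒sorted tail-dominant
    where
    head≥ : ∀ {m} (w : Vec ℕ m) → (∀ j → V.lookup w j ≤ x) → All (x ≥_) (toList w)
    head≥ V.[] _ = []
    head≥ (y V.∷ w) h = h F.zero ∷ head≥ w (h ∘ F.suc)
    tail-dominant : Dominant u
    tail-dominant i j i≤j = D (F.suc i) (F.suc j) (s≤s i≤j)

  ↭-dominant⇒⊴ : ∀ {n} {v w : Vec ℕ n} → Dominant w → toList v ↭ toList w → toList v ⊴ toList w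
  ↭-dominant⇒⊴ D = ↭-sorted⇒⊴ (dominant⇒sorted D)

  reverse-↭ : ∀ {n} {v w : Vec ℕ n} → toList v ↭ toList w → toList (V.reverse v) ↭ toList w
  reverse-↭ {v = v} p = subst (_↭ _) (sym (V.toList-reverse v)) (↭-trans (↭-reverse (toList v)) p)

  ⊴-antisymᵛ : ∀ {n} {v w : Vec ℕ n} → toList v ⊴ toList w → toList w ⊴ toList v → v ≡ w
  ⊴-antisymᵛ {v = v} {w} p q = trans (sym (V.cast-is-id refl v))
    (V.toList-injective refl v w (⊴-antisym (trans (V.length-toList v) (sym (V.length-toList w))) p q))

  ⊴-reverseᵛ : ∀ {n} {v w : Vec ℕ n} → toList v ⊴ toList w → toList (V.reverse w) ⊴ toList (V.reverse v)
  ⊴-reverseᵛ {v = v} {w} p = subst₂ _⊴_ (sym (V.toList-reverse w)) (sym (V.toList-reverse v))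
    (⊴-reverse (trans (V.length-toList v) (sym (V.length-toList w))) p)

module PairingSupport where

  open import Data.Nat as ℕ using (ℕ; zero; suc)
  open import Data.Nat.Properties using (<ᵇ⇒<; ≤-reflexive)
  open import Data.Nat.ListAction using (sum)
  open import Data.Integer using (ℤ; +_; -_; 0ℤ; -1ℤ; _+_; _-_; _*_; _≤_; -≤+)
  import Data.Integer.Properties as ℤ
  open import Algebra.Properties.CommutativeSemigroup ℤ.+-commutativeSemigroup using (interchange)
  open import Data.List using (allFin; upTo)
  open import Data.Vec using (Vec; []; _∷_; toList; reverse; map; zipWith; replicate; tabulate)
  import Data.Vec.Properties as V
  open import Data.Fin as F using (Fin)
  open import Data.Bool using (true; false; if_then_else_; T)
  open import Data.Empty using (⊥-elim)
  open import Relation.Nullary using (¬_)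
  open import Relation.Nullary.Decidable using (does; yes; no)
  open DominanceOrder using (prefixSum; _⊴_; prefixSum-all)

  prefixSumℤ : ∀ {n} → ℕ → Vec ℤ n → ℤ
  prefixSumℤ zero _ = 0ℤ
  prefixSumℤ (suc k) [] = 0ℤ
  prefixSumℤ (suc k) (x ∷ xs) = x + prefixSumℤ k xs

  -- The ℕ-span of the positive roots e_i - e_j (i < j).
  record RootCone {n} (β : Vec ℤ n) : Set where
    field
      prefixSum-nonneg : ∀ k → 0ℤ ≤ prefixSumℤ k β
      total-zero : prefixSumℤ n β ≡ 0ℤ

  open RootCone public

  prefixSumℤ-zipWith : ∀ {n} k (a b : Vec ℤ n) →
    prefixSumℤ k (zipWith _+_ a b) ≡ prefixSumℤ k a + prefixSumℤ k b
  prefixSumℤ-zipWith zero a b = refl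
  prefixSumℤ-zipWith (suc k) [] [] = refl
  prefixSumℤ-zipWith (suc k) (x ∷ a) (y ∷ b) =
    trans (cong (_+_ (x + y)) (prefixSumℤ-zipWith k a b)) (interchange x y _ _)

  prefixSumℤ-replicate : ∀ {n} k → prefixSumℤ k (replicate n 0ℤ) ≡ 0ℤ
  prefixSumℤ-replicate zero = refl
  prefixSumℤ-replicate {zero} (suc k) = refl
  prefixSumℤ-replicate {suc n} (suc k) = trans (ℤ.+-identityˡ _) (prefixSumℤ-replicate {n} k)

  prefixSumℤ-scale : ∀ {n} k c (a : Vec ℤ n) → prefixSumℤ k (map (c *_) a) ≡ c * prefixSumℤ k a
  prefixSumℤ-scale zero c a = sym (ℤ.*-zeroʳ c)
  prefixSumℤ-scale (suc k) c [] = sym (ℤ.*-zeroʳ c)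
  prefixSumℤ-scale (suc k) c (x ∷ a) =
    trans (cong (_+_ (c * x)) (prefixSumℤ-scale k c a)) (sym (ℤ.*-distribˡ-+ c x _))

  rootCone-zipWith : ∀ {n} {a b : Vec ℤ n} → RootCone a → RootCone b → RootCone (zipWith _+_ a b)
  rootCone-zipWith {n} {a} {b} ca cb = record
    { prefixSum-nonneg = λ k → subst (0ℤ ≤_) (sym (prefixSumℤ-zipWith k a b))
        (ℤ.+-mono-≤ (prefixSum-nonneg ca k) (prefixSum-nonneg cb k))
    ; total-zero = trans (prefixSumℤ-zipWith n a b) (cong₂ _+_ (total-zero ca) (total-zero cb))
    }

  rootCone-replicate : ∀ {n} → RootCone (replicate n 0ℤ)
  rootCone-replicate {n} = record
    { prefixSum-nonneg = λ k → ℤ.≤-reflexive (sym (prefixSumℤ-replicate {n} k))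
    ; total-zero = prefixSumℤ-replicate {n} n
    }

  rootCone-scale : ∀ {n} m {a : Vec ℤ n} → RootCone a → RootCone (map ((+ m) *_) a)
  rootCone-scale {n} m {a} ca = record
    { prefixSum-nonneg = λ k → subst₂ _≤_ (ℤ.*-zeroʳ (+ m)) (sym (prefixSumℤ-scale k (+ m) a))
        (ℤ.*-monoˡ-≤-nonNeg (+ m) (prefixSum-nonneg ca k))
    ; total-zero = trans (prefixSumℤ-scale n (+ m) a) (trans (cong ((+ m) *_) (total-zero ca)) (ℤ.*-zeroʳ (+ m)))
    }

  tabulate-const : ∀ {A : Set} {n} (x : A) → tabulate {n = n} (λ _ → x) ≡ replicate n x
  tabulate-const {n = zero} x = refl
  tabulate-const {n = suc n} x = cong (x ∷_) (tabulate-const x)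

  rootCone-0∷ : ∀ {n} {β : Vec ℤ n} → RootCone β → RootCone (0ℤ ∷ β)
  rootCone-0∷ cβ = record
    { prefixSum-nonneg = λ { zero → ℤ.≤-refl
                           ; (suc k) → subst (0ℤ ≤_) (sym (ℤ.+-identityˡ _)) (prefixSum-nonneg cβ k) }
    ; total-zero = trans (ℤ.+-identityˡ _) (total-zero cβ)
    }

  -- The exponent vector of 1/x_j, written so that ratioExp zero (suc j) reduces to + 1 ∷ negUnit j.
  negUnit : ∀ {n} → Fin n → Vec ℤ n
  negUnit j = tabulate (λ m → 0ℤ - (if does (m F.≟ j) then + 1 else 0ℤ))

  prefixSumℤ-negUnit-≥ : ∀ {n} (j : Fin n) k → -1ℤ ≤ prefixSumℤ k (negUnit j)
  prefixSumℤ-negUnit-≥ j zero = -≤+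
  prefixSumℤ-negUnit-≥ {suc n} F.zero (suc k) = ℤ.≤-reflexive (sym (cong (_+_ -1ℤ)
    (trans (cong (prefixSumℤ k) (tabulate-const 0ℤ)) (prefixSumℤ-replicate k))))
  prefixSumℤ-negUnit-≥ (F.suc j) (suc k) =
    subst (-1ℤ ≤_) (sym (ℤ.+-identityˡ _)) (prefixSumℤ-negUnit-≥ j k)

  prefixSumℤ-negUnit-total : ∀ {n} (j : Fin n) → prefixSumℤ n (negUnit j) ≡ -1ℤ
  prefixSumℤ-negUnit-total {suc n} F.zero =
    cong (_+_ -1ℤ) (trans (cong (prefixSumℤ n) (tabulate-const 0ℤ)) (prefixSumℤ-replicate n))
  prefixSumℤ-negUnit-total {suc n} (F.suc j) = trans (ℤ.+-identityˡ _) (prefixSumℤ-negUnit-total j)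

  rootCone-ratioExp : ∀ {n} {i j : Fin n} → i F.< j → RootCone (ratioExp i j)
  rootCone-ratioExp {i = F.zero} {F.suc j} _ = record
    { prefixSum-nonneg = λ { zero → ℤ.≤-refl
                           ; (suc k) → ℤ.+-monoʳ-≤ (+ 1) (prefixSumℤ-negUnit-≥ j k) }
    ; total-zero = cong (_+_ (+ 1)) (prefixSumℤ-negUnit-total j)
    }
  rootCone-ratioExp {i = F.suc i} {F.suc j} (ℕ.s≤s i<j) = rootCone-0∷ (rootCone-ratioExp i<j)

  AllExponents : ∀ {n} → (Vec ℤ n → Set) → Laurent n → Set
  AllExponents P f = All (P ∘ proj₂) f

  allExponents-⋆ : ∀ {n} {P Q R : Vec ℤ n → Set} {f g : Laurent n} →
    (∀ {a b} → P a → Q b → R (zipWith _+_ a b)) →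
    AllExponents P f → AllExponents Q g → AllExponents R (f ⋆ g)
  allExponents-⋆ combine [] qs = []
  allExponents-⋆ combine (p ∷ ps) qs =
    All.++⁺ (All.map⁺ (All.map (combine p) qs)) (allExponents-⋆ combine ps qs)

  nonzero-coeff⇒exponent : ∀ {n} {P : Vec ℤ n → Set} e (f : Laurent n) →
    AllExponents P f → ¬ IsZeroQ (coeff e f) → P e
  nonzero-coeff⇒exponent e [] [] nz = ⊥-elim (nz [])
  nonzero-coeff⇒exponent e ((a , e′) ∷ f) (p ∷ ps) nz with V.≡-dec ℤ._≟_ e′ e
  ... | yes refl = p
  ... | no _ = nonzero-coeff⇒exponent e f ps nz

  Increasing : ∀ {n} → Fin n × Fin n → Set
  Increasing (i , j) = i F.< j

  pairsLt-increasing : ∀ n → All Increasing (pairsLt n)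
  pairsLt-increasing n = All.concat⁺ (All.map⁺ (All.universal (λ i →
    All.concat⁺ (All.map⁺ (All.universal (λ j → if-increasing (F.toℕ i ℕ.<ᵇ F.toℕ j) (<ᵇ⇒< _ _))
      (allFin n)))) (allFin n)))
    where
    if-increasing : ∀ {p} b → (T b → Increasing p) → All Increasing (if b then p ∷ [] else [])
    if-increasing true inc = inc _ ∷ []
    if-increasing false inc = []

  allExponents-factor : ∀ {n} N {i j : Fin n} → i F.< j → AllExponents RootCone (factor N i j)
  allExponents-factor {n} N {i} {j} i<j =
    allExponents-⋆ {f = (qpow 0 , replicate n 0ℤ) ∷ (-1ℤ ∷ [] , ratioExp i j) ∷ []} rootCone-zipWith
    (rootCone-replicate ∷ rootCone-ratioExp i<j ∷ [])
    (All.map⁺ {f = λ k → (qpow k , map ((+ k) *_) (ratioExp i j))}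
      (All.universal (λ k → rootCone-scale k (rootCone-ratioExp i<j)) (upTo (suc N))))

  allExponents-Δ : ∀ n N → AllExponents RootCone (Δ n N)
  allExponents-Δ n N = foldr-preserves-All (AllExponents RootCone)
    (λ { {i , j} {acc} i<j →
      allExponents-⋆ {f = factor N i j} {g = acc} rootCone-zipWith (allExponents-factor N i<j) })
    (rootCone-replicate ∷ []) (pairsLt-increasing n)

  prefixSumℤ-pos : ∀ {n} k (w : Vec ℕ n) → prefixSumℤ k (map +_ w) ≡ + prefixSum k (toList w)
  prefixSumℤ-pos zero w = refl
  prefixSumℤ-pos (suc k) [] = refl
  prefixSumℤ-pos (suc k) (x ∷ w) = cong (_+_ (+ x)) (prefixSumℤ-pos k w)

  prefixSumℤ-neg : ∀ {n} k (w : Vec ℕ n) →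
    prefixSumℤ k (map (λ m → - (+ m)) w) ≡ - (+ prefixSum k (toList w))
  prefixSumℤ-neg zero w = refl
  prefixSumℤ-neg (suc k) [] = refl
  prefixSumℤ-neg (suc k) (x ∷ w) =
    trans (cong (_+_ (- (+ x))) (prefixSumℤ-neg k w))
      (sym (ℤ.neg-distrib-+ (+ x) (+ prefixSum k (toList w))))

  -- The exponent vector of x^v (x^w)^♣.
  monomialExponent : ∀ {n} → Vec ℕ n → Vec ℕ n → Vec ℤ n
  monomialExponent v w = zipWith _+_ (map +_ v) (reverse (map (λ m → - (+ m)) w))

  prefixSumℤ-monomialExponent : ∀ {n} k (v w : Vec ℕ n) →
    prefixSumℤ k (monomialExponent v w) ≡ + prefixSum k (toList v) - + prefixSum k (toList (reverse w))
  prefixSumℤ-monomialExponent k v w = trans (prefixSumℤ-zipWith k _ _) (cong₂ _+_ (prefixSumℤ-pos k v)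
    (trans (cong (prefixSumℤ k) (sym (V.map-reverse _ w))) (prefixSumℤ-neg k (reverse w))))

  pairing-nonzero⇒cancelling : ∀ {n} (v w : Vec ℕ n) → ¬ IsZeroQ (pairing (mono v) (mono w)) →
    ∃[ β ] RootCone β × zipWith _+_ (monomialExponent v w) β ≡ replicate n 0ℤ
  pairing-nonzero⇒cancelling {n} v w nz = nonzero-coeff⇒exponent {P = Cancelled} (replicate n 0ℤ)
    (toLaurent (mono v) ⋆ club (mono w) ⋆ Δ n (truncBound (mono w)))
    (allExponents-⋆ {P = _≡ monomialExponent v w} {f = toLaurent (mono v) ⋆ club (mono w)}
      (λ { refl cβ → _ , cβ , refl }) (refl ∷ []) (allExponents-Δ n (truncBound (mono w))))
    nz
    where
    Cancelled : Vec ℤ n → Set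
    Cancelled e = ∃[ β ] RootCone β × zipWith _+_ (monomialExponent v w) β ≡ e

  cancelling⇒⊴ : ∀ {n} (v w : Vec ℕ n) {β} → RootCone β →
    zipWith _+_ (monomialExponent v w) β ≡ replicate n 0ℤ → toList v ⊴ toList (reverse w)
  cancelling⇒⊴ {n} v w {β} cβ cancels = record { prefixSum-≤ = prefixSum-≤ ; sum-≡ = sum-≡ }
    where
    α = monomialExponent v w

    α+β≡0 : ∀ k → prefixSumℤ k α + prefixSumℤ k β ≡ 0ℤ
    α+β≡0 k = trans (sym (prefixSumℤ-zipWith k α β))
      (trans (cong (prefixSumℤ k) cancels) (prefixSumℤ-replicate k))

    prefixSum-≤ : ∀ k → prefixSum k (toList v) ℕ.≤ prefixSum k (toList (reverse w))
    prefixSum-≤ k = ℤ.drop‿+≤+ (ℤ.i-j≤0⇒i≤j (subst (_≤ 0ℤ) (prefixSumℤ-monomialExponent k v w)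
      (subst₂ _≤_ (ℤ.+-identityʳ _) (α+β≡0 k) (ℤ.+-monoʳ-≤ (prefixSumℤ k α) (prefixSum-nonneg cβ k)))))

    prefixSum-total : prefixSum n (toList v) ≡ prefixSum n (toList (reverse w))
    prefixSum-total = ℤ.+-injective (ℤ.i-j≡0⇒i≡j _ _ (begin
      _                                     ≡⟨ prefixSumℤ-monomialExponent n v w ⟨
      prefixSumℤ n α                        ≡⟨ ℤ.+-identityʳ _ ⟨
      prefixSumℤ n α + 0ℤ                   ≡⟨ cong (_+_ (prefixSumℤ n α)) (total-zero cβ) ⟨
      prefixSumℤ n α + prefixSumℤ n β       ≡⟨ α+β≡0 n ⟩
      0ℤ                                    ∎))
      where open ≡-Reasoning

    sum-≡ : sum (toList v) ≡ sum (toList (reverse w))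
    sum-≡ = trans (sym (prefixSum-all (toList v) (≤-reflexive (V.length-toList v))))
      (trans prefixSum-total
        (prefixSum-all (toList (reverse w)) (≤-reflexive (V.length-toList (reverse w)))))

  pairing-nonzero⇒⊴ : ∀ {n} (v w : Vec ℕ n) → ¬ IsZeroQ (pairing (mono v) (mono w)) →
    toList v ⊴ toList (reverse w)
  pairing-nonzero⇒⊴ v w nz with _ , cβ , cancels ← pairing-nonzero⇒cancelling v w nz =
    cancelling⇒⊴ v w cβ cancels

open DominanceOrder
open PairingSupport using (pairing-nonzero⇒⊴)
open import Data.Nat using (ℕ; _≤_)
open import Data.Vec using (Vec; toList; reverse)
open import Data.Vec.Properties using (reverse-involutive; reverse-reverse)
open import Relation.Nullary using (¬_)

lemma7 : (n : ℕ) → 1 ≤ n → (u la v mu : Vec ℕ n) →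
  Dominant u → Dominant la →
  toList v ↭ toList u → toList mu ↭ toList la →
  ¬ IsZeroQ (pairing (mono v) (mono la)) →
  ¬ IsZeroQ (pairing (mono u) (mono mu)) →
  (u ≡ la) × (v ≡ reverse la) × (mu ≡ reverse u)
lemma7 n _ u la v mu u-dominant la-dominant v↭u mu↭la nz₁ nz₂ =
  u≡la , sym (reverse-reverse vω≡la) , sym (reverse-reverse μω≡u)
  where
  v⊴λω : toList v ⊴ toList (reverse la)
  v⊴λω = pairing-nonzero⇒⊴ v la nz₁
  u⊴μω : toList u ⊴ toList (reverse mu)
  u⊴μω = pairing-nonzero⇒⊴ u mu nz₂
  μω⊴λ : toList (reverse mu) ⊴ toList la
  μω⊴λ = ↭-dominant⇒⊴ la-dominant (reverse-↭ mu↭la)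
  vω⊴u : toList (reverse v) ⊴ toList u
  vω⊴u = ↭-dominant⇒⊴ u-dominant (reverse-↭ v↭u)
  λ⊴vω : toList la ⊴ toList (reverse v)
  λ⊴vω = subst (λ x → toList x ⊴ toList (reverse v)) (reverse-involutive la) (⊴-reverseᵛ v⊴λω)
  u⊴λ : toList u ⊴ toList la
  u⊴λ = ⊴-trans u⊴μω μω⊴λ
  λ⊴u : toList la ⊴ toList u
  λ⊴u = ⊴-trans λ⊴vω vω⊴u
  u≡la : u ≡ la
  u≡la = ⊴-antisymᵛ u⊴λ λ⊴u
  vω≡la : reverse v ≡ la
  vω≡la = ⊴-antisymᵛ (⊴-trans vω⊴u u⊴λ) λ⊴vω
  μω≡u : reverse mu ≡ u
  μω≡u = ⊴-antisymᵛ (⊴-trans μω⊴λ λ⊴u) u⊴μω
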